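{- Let \[\mathrm Y=\begin{pmatrix}1&1&1&1&0&0\\1&1&1&0&1&0\\1&1&1&0&0&1\\0&1&1&0&0&0\\1&0&1&0&0&0\\1&1&0&0&0&0\end{pmatrix}.\] Then $\mathrm Y$ does not satisfy the convex Ramsey condition: there do not exist $r\geq1$, an $r\times6$ matrix $\mathrm X$ each of whose rows is a row of $\mathrm Y$, and a probability $1\times r$ matrix $\mathrm R$ such that $\mathrm R\times\mathrm X\times\mathrm W\leq\frac12$ for every Dirac-weight $6\times1$ matrix $\mathrm W$.
   Context: A probability $1\times r$ matrix is a row vector of nonnegative reals summing to $1$. An $m\times1$ matrix $\mathrm W$ is a Dirac-weight matrix if exactly one entry equals $1$, exactly one entry equals $-1$, and all other entries are $0$.
   Formalization: The entries of the probability matrix $\mathrm R$ are taken in ℚ rather than in the reals. -}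

module Defs where

open import Data.Nat using (ℕ; zero; suc)
open import Data.Fin using (Fin; zero; suc)
open import Data.Product using (∃; ∃-syntax; _×_)
open import Relation.Binary.PropositionalEquality using (_≡_; _≢_)
open import Data.Rational using (ℚ; 0ℚ; 1ℚ; _+_; _*_; -_)

Σℚ : {n : ℕ} → (Fin n → ℚ) → ℚ
Σℚ {zero}  f = 0ℚ
Σℚ {suc n} f = f zero + Σℚ (λ i → f (suc i))

-- the 6×6 matrix Y (rows then columns, 0-indexed)
Yrow : Fin 6 → Fin 6 → ℚ
Yrow i j = lk i j
  where
  b : ℕ → ℚ
  b zero = 0ℚ
  b (suc _) = 1ℚ
  r : ℕ → ℕ → ℕ → ℕ → ℕ → ℕ → Fin 6 → ℚ
  r a0 a1 a2 a3 a4 a5 zero = b a0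
  r a0 a1 a2 a3 a4 a5 (suc zero) = b a1
  r a0 a1 a2 a3 a4 a5 (suc (suc zero)) = b a2
  r a0 a1 a2 a3 a4 a5 (suc (suc (suc zero))) = b a3
  r a0 a1 a2 a3 a4 a5 (suc (suc (suc (suc zero)))) = b a4
  r a0 a1 a2 a3 a4 a5 (suc (suc (suc (suc (suc zero))))) = b a5
  lk : Fin 6 → Fin 6 → ℚ
  lk zero = r 1 1 1 1 0 0
  lk (suc zero) = r 1 1 1 0 1 0
  lk (suc (suc zero)) = r 1 1 1 0 0 1
  lk (suc (suc (suc zero))) = r 0 1 1 0 0 0
  lk (suc (suc (suc (suc zero)))) = r 1 0 1 0 0 0
  lk (suc (suc (suc (suc (suc zero))))) = r 1 1 0 0 0 0

Y : Fin 6 → Fin 6 → ℚ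
Y = Yrow

IsDiracWeight : {m : ℕ} → (Fin m → ℚ) → Set
IsDiracWeight {m} W =
  ∃[ a ] ∃[ b ] (a ≢ b × W a ≡ 1ℚ × W b ≡ - 1ℚ ×
                 (∀ c → c ≢ a → c ≢ b → W c ≡ 0ℚ))

IsProbability : {r : ℕ} → (Fin r → ℚ) → Set
IsProbability R = (∀ k → 0ℚ Data.Rational.≤ R k) × Σℚ R ≡ 1ℚ

RXW : {r m : ℕ} → (Fin r → ℚ) → (Fin r → Fin m → ℚ) → (Fin m → ℚ) → ℚ
RXW R X W = Σℚ (λ k → Σℚ (λ j → R k * X k j * W j))

{-# OPTIONS --safe #-}
module Submission where

-- Test against the three Dirac weights e₀ − e₃, e₁ − e₄, e₂ − e₅. Their sum
-- (1, 1, 1, −1, −1, −1) pairs with every row of Y to 2, so by linearity of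
-- R × X × W in W and Σ R = 1 the three values of R × X × W add up to 2,
-- whereas each is at most ½.

open import Defs
open import Data.Nat using (ℕ; _≥_)
open import Data.Fin using (Fin)
open import Data.Product using (∃; ∃-syntax; _×_)
open import Relation.Nullary using (¬_)
open import Relation.Binary.PropositionalEquality using (_≡_)
open import Data.Rational using (ℚ; _≤_; ½)

open import Algebra.Bundles using (CommutativeRing)
open import Data.Fin using (zero; suc; #_; _≟_)
open import Data.Product using (_,_)
open import Data.Vec.Functional using (Vector)
open import Data.Rational using (0ℚ; 1ℚ; _+_; _*_; -_)
open import Data.Rational.Properties using (+-*-commutativeRing; *-distribˡ-+; *-assoc; *-comm; *-identityʳ; +-mono-≤; _≤?_)
open import Relation.Binary.PropositionalEquality using (refl; sym; trans; cong; cong₂; subst; _≢_; module ≡-Reasoning)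
open import Relation.Nullary using (yes; no; contradiction)
open import Relation.Nullary.Decidable using (from-no)

open CommutativeRing +-*-commutativeRing using (semiring)
open import Algebra.Properties.Semiring.Sum semiring
  using (sum; sum-syntax; ∑-distrib-+; *-distribˡ-sum; sum-cong-≗)

Σℚ≡sum : ∀ {n} (f : Vector ℚ n) → Σℚ f ≡ sum f
Σℚ≡sum {ℕ.zero}  f = refl
Σℚ≡sum {ℕ.suc n} f = cong (f zero +_) (Σℚ≡sum (λ i → f (suc i)))

module _ {r m : ℕ} (R : Fin r → ℚ) (X : Fin r → Fin m → ℚ) where

  RXW≡∑∑ : ∀ W → RXW R X W ≡ ∑[ k < r ] ∑[ j < m ] (R k * X k j * W j)
  RXW≡∑∑ W = trans (Σℚ≡sum (λ k → Σℚ (λ j → R k * X k j * W j)))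
                    (sum-cong-≗ (λ k → Σℚ≡sum (λ j → R k * X k j * W j)))

  RXW-+ : ∀ W W′ → RXW R X (λ j → W j + W′ j) ≡ RXW R X W + RXW R X W′
  RXW-+ W W′ = begin
    RXW R X (λ j → W j + W′ j)
      ≡⟨ RXW≡∑∑ (λ j → W j + W′ j) ⟩
    ∑[ k < r ] ∑[ j < m ] (R k * X k j * (W j + W′ j))
      ≡⟨ sum-cong-≗ (λ k → sum-cong-≗ (λ j → *-distribˡ-+ (R k * X k j) (W j) (W′ j))) ⟩
    ∑[ k < r ] ∑[ j < m ] (R k * X k j * W j + R k * X k j * W′ j)
      ≡⟨ sum-cong-≗ (λ k → ∑-distrib-+ (λ j → R k * X k j * W j) (λ j → R k * X k j * W′ j)) ⟩
    ∑[ k < r ] (∑[ j < m ] (R k * X k j * W j) + ∑[ j < m ] (R k * X k j * W′ j))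
      ≡⟨ ∑-distrib-+ (λ k → ∑[ j < m ] (R k * X k j * W j)) (λ k → ∑[ j < m ] (R k * X k j * W′ j)) ⟩
    ∑[ k < r ] ∑[ j < m ] (R k * X k j * W j) + ∑[ k < r ] ∑[ j < m ] (R k * X k j * W′ j)
      ≡⟨ sym (cong₂ _+_ (RXW≡∑∑ W) (RXW≡∑∑ W′)) ⟩
    RXW R X W + RXW R X W′ ∎
    where open ≡-Reasoning

  RXW-rowConstant : ∀ W c → (∀ k → ∑[ j < m ] (X k j * W j) ≡ c) → RXW R X W ≡ c * Σℚ R
  RXW-rowConstant W c rowsX·W≡c = begin
    RXW R X W
      ≡⟨ RXW≡∑∑ W ⟩
    ∑[ k < r ] ∑[ j < m ] (R k * X k j * W j)
      ≡⟨ sum-cong-≗ (λ k → sum-cong-≗ (λ j → *-assoc (R k) (X k j) (W j))) ⟩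
    ∑[ k < r ] ∑[ j < m ] (R k * (X k j * W j))
      ≡⟨ sum-cong-≗ (λ k → sym (*-distribˡ-sum (R k) (λ j → X k j * W j))) ⟩
    ∑[ k < r ] (R k * ∑[ j < m ] (X k j * W j))
      ≡⟨ sum-cong-≗ (λ k → trans (cong (R k *_) (rowsX·W≡c k)) (*-comm (R k) c)) ⟩
    ∑[ k < r ] (c * R k)
      ≡⟨ sym (*-distribˡ-sum c R) ⟩
    c * sum R
      ≡⟨ cong (c *_) (sym (Σℚ≡sum R)) ⟩
    c * Σℚ R ∎
    where open ≡-Reasoning

dirac : ∀ {m} → Fin m → Fin m → Fin m → ℚ
dirac a b c with c ≟ a | c ≟ b
... | yes _ | _     = 1ℚ
... | no _  | yes _ = - 1ℚ
... | no _  | no _  = 0ℚ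

dirac-isDiracWeight : ∀ {m} {a b : Fin m} → a ≢ b → IsDiracWeight (dirac a b)
dirac-isDiracWeight {a = a} {b} a≢b = a , b , a≢b , at-a , at-b , elsewhere
  where
  at-a : dirac a b a ≡ 1ℚ
  at-a with a ≟ a
  ... | yes _  = refl
  ... | no a≢a = contradiction refl a≢a

  at-b : dirac a b b ≡ - 1ℚ
  at-b with b ≟ a | b ≟ b
  ... | yes b≡a | _       = contradiction (sym b≡a) a≢b
  ... | no _    | yes _   = refl
  ... | no _    | no b≢b  = contradiction refl b≢b

  elsewhere : ∀ c → c ≢ a → c ≢ b → dirac a b c ≡ 0ℚ
  elsewhere c c≢a c≢b with c ≟ a | c ≟ b
  ... | yes c≡a | _       = contradiction c≡a c≢a
  ... | no _    | yes c≡b = contradiction c≡b c≢b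
  ... | no _    | no _    = refl

W₁ W₂ W₃ W₁₂₃ : Fin 6 → ℚ
W₁ = dirac (# 0) (# 3)
W₂ = dirac (# 1) (# 4)
W₃ = dirac (# 2) (# 5)
W₁₂₃ j = W₁ j + W₂ j + W₃ j

Y-row·W₁₂₃≡2 : ∀ i → ∑[ j < 6 ] (Y i j * W₁₂₃ j) ≡ 1ℚ + 1ℚ
Y-row·W₁₂₃≡2 zero                                = refl
Y-row·W₁₂₃≡2 (suc zero)                          = refl
Y-row·W₁₂₃≡2 (suc (suc zero))                    = refl
Y-row·W₁₂₃≡2 (suc (suc (suc zero)))              = refl
Y-row·W₁₂₃≡2 (suc (suc (suc (suc zero))))        = refl
Y-row·W₁₂₃≡2 (suc (suc (suc (suc (suc zero))))) = refl

RXW-W₁+W₂+W₃≡2 : ∀ {r} (R : Fin r → ℚ) (X : Fin r → Fin 6 → ℚ) →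
                 (∀ k → ∃[ i ] (∀ j → X k j ≡ Y i j)) → Σℚ R ≡ 1ℚ →
                 RXW R X W₁ + RXW R X W₂ + RXW R X W₃ ≡ 1ℚ + 1ℚ
RXW-W₁+W₂+W₃≡2 R X rowsOfY ΣR≡1 = begin
  RXW R X W₁ + RXW R X W₂ + RXW R X W₃
    ≡⟨ sym (trans (RXW-+ R X (λ j → W₁ j + W₂ j) W₃) (cong (_+ RXW R X W₃) (RXW-+ R X W₁ W₂))) ⟩
  RXW R X W₁₂₃
    ≡⟨ RXW-rowConstant R X W₁₂₃ (1ℚ + 1ℚ) rows·W₁₂₃≡2 ⟩
  (1ℚ + 1ℚ) * Σℚ R
    ≡⟨ cong ((1ℚ + 1ℚ) *_) ΣR≡1 ⟩
  (1ℚ + 1ℚ) * 1ℚ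
    ≡⟨ *-identityʳ (1ℚ + 1ℚ) ⟩
  1ℚ + 1ℚ ∎
  where
  open ≡-Reasoning

  rows·W₁₂₃≡2 : ∀ k → ∑[ j < 6 ] (X k j * W₁₂₃ j) ≡ 1ℚ + 1ℚ
  rows·W₁₂₃≡2 k with rowsOfY k
  ... | i , Xk≗Yi = trans (sum-cong-≗ (λ j → cong (_* W₁₂₃ j) (Xk≗Yi j))) (Y-row·W₁₂₃≡2 i)

lemma3p13 : ¬ (∃[ r ] ∃[ X ] ∃[ R ]
                 (r ≥ 1
                  × (∀ (k : Fin r) → ∃[ i ] (∀ j → X k j ≡ Y i j))
                  × IsProbability {r} R
                  × (∀ (W : Fin 6 → ℚ) → IsDiracWeight W → RXW R X W ≤ ½)))
lemma3p13 (_ , X , R , _ , rowsOfY , (_ , ΣR≡1) , RXW≤½) =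
  from-no (1ℚ + 1ℚ ≤? ½ + ½ + ½)
    (subst (_≤ ½ + ½ + ½) (RXW-W₁+W₂+W₃≡2 R X rowsOfY ΣR≡1)
      (+-mono-≤ (+-mono-≤ (RXW≤½ W₁ (dirac-isDiracWeight λ ()))
                          (RXW≤½ W₂ (dirac-isDiracWeight λ ())))
                (RXW≤½ W₃ (dirac-isDiracWeight λ ()))))
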